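{- For every integer $n \geq 2$, $\operatorname{adim}(P_2 \square P_n) \leq \left\lceil \frac{3n-1}{4}\right\rceil$.
   Context: $P_n$ is the path on $n$ vertices and $\square$ the Cartesian product of graphs: $V(G_1\square G_2)=V(G_1)\times V(G_2)$, with $(u,u')\sim(v,v')$ iff ($u=v$ and $u'v'\in E(G_2)$) or ($u'=v'$ and $uv\in E(G_1)$). For vertices $u,v$, $d(u,v)$ is the shortest-path distance and $d_1(u,v) := \min(d(u,v),2)$. A set $A \subseteq V(G)$ is an adjacency resolving set of $G$ if for any distinct $x,y \in V(G)$ there is $z \in A$ with $d_1(z,x) \neq d_1(z,y)$; $\operatorname{adim}(G)$ is the minimum cardinality of such a set. -}

module Defs where

open import Data.Nat using (ℕ; zero; suc; _≤_; _+_; _*_)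
open import Data.Fin using (Fin; toℕ)
open import Data.Fin.Properties using () renaming (_≟_ to _≟F_)
open import Data.Product using (_×_; _,_; ∃)
open import Data.Product.Properties using (≡-dec)
open import Data.Sum using (_⊎_)
open import Data.List using (List; length)
open import Data.List.Membership.Propositional using (_∈_)
open import Relation.Nullary using (¬_; Dec; yes; no)
open import Relation.Nullary.Decidable using (_⊎-dec_; _×-dec_)
open import Relation.Binary.PropositionalEquality using (_≡_)
open import Relation.Binary.Definitions using (DecidableEquality)
import Data.Nat.Properties as ℕP

-- A (simple) graph: a vertex type with decidable equality and a decidable
-- adjacency relation (used symmetrically and irreflexively below).
record Graph : Set₁ where
  field
    V    : Set
    _≟_  : DecidableEquality V
    Adj  : V → V → Set
    adj? : (u v : V) → Dec (Adj u v)

open Graph public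

PathAdj : {n : ℕ} → Fin n → Fin n → Set
PathAdj i j = (suc (toℕ i) ≡ toℕ j) ⊎ (suc (toℕ j) ≡ toℕ i)

P : ℕ → Graph
P n = record
  { V = Fin n
  ; _≟_ = _≟F_
  ; Adj = PathAdj
  ; adj? = λ i j → (suc (toℕ i) ℕP.≟ toℕ j) ⊎-dec (suc (toℕ j) ℕP.≟ toℕ i)
  }

ProdAdj : (G₁ G₂ : Graph) → V G₁ × V G₂ → V G₁ × V G₂ → Set
ProdAdj G₁ G₂ (u , u′) (v , v′) =
  (u ≡ v × Adj G₂ u′ v′) ⊎ (u′ ≡ v′ × Adj G₁ u v)

_□_ : Graph → Graph → Graph
G₁ □ G₂ = record
  { V = V G₁ × V G₂
  ; _≟_ = ≡-dec (_≟_ G₁) (_≟_ G₂)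
  ; Adj = ProdAdj G₁ G₂
  ; adj? = λ { (u , u′) (v , v′) →
      ((_≟_ G₁ u v) ×-dec (adj? G₂ u′ v′)) ⊎-dec ((_≟_ G₂ u′ v′) ×-dec (adj? G₁ u v)) }
  }

-- Truncated distance d₁(u,v) = min(d(u,v), 2) in a simple graph:
-- 0 if u = v, 1 if u and v are adjacent, 2 otherwise (including unreachable).
d₁ : (G : Graph) → V G → V G → ℕ
d₁ G u v with _≟_ G u v
... | yes _ = 0
... | no _ with adj? G u v
...   | yes _ = 1
...   | no _ = 2

IsAdjResolving : (G : Graph) → List (V G) → Set
IsAdjResolving G A =
  (x y : V G) → ¬ (x ≡ y) → ∃ λ z → z ∈ A × ¬ (d₁ G z x ≡ d₁ G z y)

adim≤ : Graph → ℕ → Set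
adim≤ G k = ∃ λ (A : List (V G)) → IsAdjResolving G A × length A ≤ k

-- Six landmarks (0,0), (0,2), (1,2), (1,4), (0,6), (1,6) in the first eight
-- columns of the ladder P₂ □ Pₙ₊₈, together with an adjacency resolving set of
-- P₂ □ Pₙ containing the corner (0,0) shifted eight columns to the right,
-- resolve P₂ □ Pₙ₊₈.  Pairs in the shifted part are resolved by the shifted set,
-- since d₁ only sees equality and adjacency; pairs in the first eight columns are
-- resolved by the landmarks and the shifted corner (0,8), a finite check; and in
-- a mixed pair, the left vertex is dominated by a landmark, which is at distance
-- at least 2 from every vertex in columns ≥ 8.  Each period of eight columns thus
-- costs 6 = 3·8/4 vertices, and ⌈(3n−1)/4⌉ = ⌊(3n+2)/4⌋ follows by induction
-- from the cases n ≤ 8, which are checked by computation.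
module Submission where

open import Defs
open import Data.Nat using (ℕ; zero; suc; _≤_; _<_; _+_; _*_; _/_; s≤s; _≤?_)
open import Data.Nat.Properties as ℕ using (suc-injective; ≤-trans; +-monoʳ-≤; *-distribˡ-+; +-assoc)
open import Data.Nat.Divisibility using (divides-refl)
open import Data.Nat.DivMod using (+-distrib-/-∣ˡ)
open import Data.Fin using (Fin; zero; suc; toℕ; _↑ˡ_; _↑ʳ_; #_)
open import Data.Fin.Properties using (all?; ↑ʳ-injective)
open import Data.Product using (_×_; _,_; ∃; proj₂)
open import Data.Product.Properties using (,-injectiveˡ; ,-injectiveʳ)
open import Data.Product.Function.NonDependent.Propositional using (_×-⇔_)
open import Data.Sum using (inj₁; inj₂)
open import Data.Sum.Function.Propositional using (_⊎-⇔_)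
open import Data.List using (List; []; _∷_; length; map; _++_)
open import Data.List.Properties using (length-map)
open import Data.List.Membership.Propositional using (_∈_; find; lose)
open import Data.List.Membership.Propositional.Properties using (∈-++⁺ˡ; ∈-++⁺ʳ; ∈-map⁺)
open import Data.List.Relation.Unary.Any using (here; there; any?)
open import Data.List.Relation.Unary.All as All using (All)
open import Function using (_∘_)
open import Function.Bundles using (_⇔_; mk⇔; Equivalence)
open import Function.Construct.Identity using (⇔-id)
open import Function.Properties.Equivalence using () renaming (trans to ⇔-trans)
open import Relation.Nullary using (¬_; Dec; yes; no; contradiction; ¬?)
open import Relation.Nullary.Decidable using (True; toWitness; map′; _→-dec_)
open import Relation.Binary.PropositionalEquality using (_≡_; _≢_; refl; sym; trans; cong; cong₂; subst)
open import Relation.Binary.PropositionalEquality using (module ≡-Reasoning)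

open Equivalence using (to; from)

d₁-cong : ∀ {G H : Graph} {u v : V G} {u′ v′ : V H} →
          (u ≡ v) ⇔ (u′ ≡ v′) → Adj G u v ⇔ Adj H u′ v′ → d₁ G u v ≡ d₁ H u′ v′
d₁-cong {G} {H} {u} {v} {u′} {v′} eq adj with _≟_ G u v | _≟_ H u′ v′
... | yes _  | yes _  = refl
... | yes p  | no ¬q  = contradiction (to eq p) ¬q
... | no ¬p  | yes q  = contradiction (from eq q) ¬p
... | no _   | no _ with adj? G u v | adj? H u′ v′
...   | yes _  | yes _  = refl
...   | yes a  | no ¬b  = contradiction (to adj a) ¬b
...   | no ¬a  | yes b  = contradiction (from adj b) ¬a
...   | no _   | no _   = refl

d₁-nonadjacent : ∀ (G : Graph) {u v : V G} → u ≢ v → ¬ Adj G u v → d₁ G u v ≡ 2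
d₁-nonadjacent G {u} {v} u≢v ¬adj with _≟_ G u v
... | yes u≡v = contradiction u≡v u≢v
... | no _ with adj? G u v
...   | yes adj = contradiction adj ¬adj
...   | no _    = refl

Resolves : (G : Graph) → List (V G) → V G → V G → Set
Resolves G A x y = ∃ λ z → z ∈ A × d₁ G z x ≢ d₁ G z y

resolves? : (G : Graph) (A : List (V G)) (x y : V G) → Dec (Resolves G A x y)
resolves? G A x y =
  map′ find (λ (_ , z∈A , d≢) → lose z∈A d≢) (any? (λ z → ¬? (d₁ G z x ℕ.≟ d₁ G z y)) A)

Resolves-sym : ∀ {G A x y} → Resolves G A x y → Resolves G A y x
Resolves-sym (z , z∈A , d≢) = z , z∈A , d≢ ∘ sym

Resolves-⊆ : ∀ {G A B x y} → (∀ {z} → z ∈ A → z ∈ B) → Resolves G A x y → Resolves G B x y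
Resolves-⊆ A⊆B (z , z∈A , d≢) = z , A⊆B z∈A , d≢

Resolves-separating : ∀ {G A x y z} → z ∈ A → d₁ G z x ≤ 1 → d₁ G z y ≡ 2 → Resolves G A x y
Resolves-separating z∈A dzx≤1 dzy≡2 =
  _ , z∈A , λ dzx≡dzy → contradiction (subst (_≤ 1) (trans dzx≡dzy dzy≡2) dzx≤1) λ { (s≤s ()) }

AdjResolvingContaining : (G : Graph) → V G → ℕ → Set
AdjResolvingContaining G z k = ∃ λ A → IsAdjResolving G A × length A ≤ k × z ∈ A

Ladder : ℕ → Graph
Ladder n = P 2 □ P n

corner : ∀ {n} → V (Ladder (suc n))
corner = zero , zero

all-vertices? : ∀ {n} {Q : V (Ladder n) → Set} → (∀ v → Dec (Q v)) → Dec (∀ v → Q v)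
all-vertices? Q? = map′ (λ q (r , i) → q r i) (λ q r i → q (r , i)) (all? λ r → all? λ i → Q? (r , i))

isAdjResolving? : ∀ n (A : List (V (Ladder n))) → Dec (IsAdjResolving (Ladder n) A)
isAdjResolving? n A = all-vertices? λ x → all-vertices? λ y →
  ¬? (_≟_ (Ladder n) x y) →-dec resolves? (Ladder n) A x y

pathAdj-suc : ∀ {n} {i j : Fin n} → PathAdj (suc i) (suc j) ⇔ PathAdj i j
pathAdj-suc = mk⇔ (λ { (inj₁ e) → inj₁ (suc-injective e) ; (inj₂ e) → inj₂ (suc-injective e) })
                  (λ { (inj₁ e) → inj₁ (cong suc e) ; (inj₂ e) → inj₂ (cong suc e) })

pathAdj-↑ʳ : ∀ k {n} {i j : Fin n} → PathAdj (k ↑ʳ i) (k ↑ʳ j) ⇔ PathAdj i j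
pathAdj-↑ʳ zero    = ⇔-id _
pathAdj-↑ʳ (suc k) = ⇔-trans pathAdj-suc (pathAdj-↑ʳ k)

shift : ∀ k {n} → V (Ladder n) → V (Ladder (k + n))
shift k (r , i) = r , k ↑ʳ i

d₁-shift : ∀ k {n} (u v : V (Ladder n)) →
           d₁ (Ladder (k + n)) (shift k u) (shift k v) ≡ d₁ (Ladder n) u v
d₁-shift k {n} (r , i) (s , j) =
  d₁-cong {Ladder (k + n)} {Ladder n} shift-≡ (((⇔-id _) ×-⇔ pathAdj-↑ʳ k) ⊎-⇔ (↑ʳ-≡ ×-⇔ ⇔-id _))
  where
  ↑ʳ-≡ : (k ↑ʳ i ≡ k ↑ʳ j) ⇔ (i ≡ j)
  ↑ʳ-≡ = mk⇔ (↑ʳ-injective k i j) (cong (k ↑ʳ_))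
  shift-≡ : (shift k (r , i) ≡ shift k (s , j)) ⇔ ((r , i) ≡ (s , j))
  shift-≡ = mk⇔ (λ e → cong₂ _,_ (,-injectiveˡ e) (to ↑ʳ-≡ (,-injectiveʳ e))) (cong (shift k))

Resolves-shift : ∀ k {n} {A : List (V (Ladder n))} {x y} → Resolves (Ladder n) A x y →
                 Resolves (Ladder (k + n)) (map (shift k) A) (shift k x) (shift k y)
Resolves-shift k {x = x} {y} (z , z∈A , d≢) =
  shift k z , ∈-map⁺ (shift k) z∈A ,
  λ e → d≢ (trans (sym (d₁-shift k z x)) (trans e (d₁-shift k z y)))

d₁-distant-columns : ∀ {n} {r s : Fin 2} {i j : Fin n} →
                     2 + toℕ i ≤ toℕ j → d₁ (Ladder n) (r , i) (s , j) ≡ 2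
d₁-distant-columns {n} {r} {s} {i} {j} gap =
  d₁-nonadjacent (Ladder n) (ℕ.<⇒≢ i<j ∘ cong toℕ ∘ ,-injectiveʳ) nonadjacent
  where
  i<j : toℕ i < toℕ j
  i<j = ℕ.m+n≤o⇒n≤o 1 gap
  nonadjacent : ¬ ProdAdj (P 2) (P n) (r , i) (s , j)
  nonadjacent (inj₁ (_ , inj₁ e)) = ℕ.<⇒≢ gap e
  nonadjacent (inj₁ (_ , inj₂ e)) = ℕ.<⇒≢ (ℕ.m<n⇒m<1+n i<j) (sym e)
  nonadjacent (inj₂ (e , _))      = ℕ.<⇒≢ i<j (cong toℕ e)

data Split (k : ℕ) {n : ℕ} : Fin (k + n) → Set where
  left  : (i : Fin k) → Split k (i ↑ˡ n)
  right : (j : Fin n) → Split k (k ↑ʳ j)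

split : ∀ k {n} (i : Fin (k + n)) → Split k i
split zero    i       = right i
split (suc k) zero    = left zero
split (suc k) (suc i) with split k i
... | left i′  = left (suc i′)
... | right j  = right j

embedˡ : ∀ {n} → V (Ladder 8) → V (Ladder (8 + n))
embedˡ (r , k) = r , k ↑ˡ _

landmarks : ∀ {n} → List (V (Ladder (8 + n)))
landmarks = (# 0 , # 0) ∷ (# 0 , # 2) ∷ (# 1 , # 2) ∷ (# 1 , # 4) ∷ (# 0 , # 6) ∷ (# 1 , # 6) ∷ []

landmark-columns≤6 : ∀ {n} → All (λ z → toℕ (proj₂ z) ≤ 6) (landmarks {n})
landmark-columns≤6 = toWitness {a? = All.all? (λ z → toℕ (proj₂ z) ≤? 6) landmarks} _

-- The next two facts are decided by evaluation, uniformly in the length of the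
-- ladder: only its first nine columns are ever inspected.
landmarks-dominate : ∀ {n} (v : V (Ladder 8)) → ∃ λ z → z ∈ landmarks × d₁ (Ladder (8 + n)) z (embedˡ v) ≤ 1
landmarks-dominate {n} = find ∘ toWitness {a? = all-vertices? λ v →
  any? (λ z → d₁ (Ladder (8 + n)) z (embedˡ v) ≤? 1) landmarks} _

landmarks-resolve-first-columns : ∀ {m} (x y : V (Ladder 8)) → x ≢ y →
  Resolves (Ladder (8 + suc m)) (shift 8 corner ∷ landmarks) (embedˡ x) (embedˡ y)
landmarks-resolve-first-columns {m} = toWitness {a? = all-vertices? λ x → all-vertices? λ y →
  ¬? (_≟_ (Ladder 8) x y) →-dec
  resolves? (Ladder (8 + suc m)) (shift 8 corner ∷ landmarks) (embedˡ x) (embedˡ y)} _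

landmarks-separate : ∀ {n} (v : V (Ladder 8)) (w : V (Ladder n)) →
                     Resolves (Ladder (8 + n)) landmarks (embedˡ v) (shift 8 w)
landmarks-separate {n} v (s , j) with landmarks-dominate v
... | (r , c) , z∈landmarks , dominated =
  Resolves-separating {Ladder (8 + n)} z∈landmarks dominated (d₁-distant-columns {r = r} {s} gap)
  where
  gap : 2 + toℕ c ≤ 8 + toℕ j
  gap = ≤-trans (s≤s (s≤s (All.lookup landmark-columns≤6 z∈landmarks))) (ℕ.m≤m+n 8 (toℕ j))

extend : ∀ {m k} → AdjResolvingContaining (Ladder (suc m)) corner k →
         AdjResolvingContaining (Ladder (8 + suc m)) corner (6 + k)
extend {m} {k} (A , resolving , |A|≤k , corner∈A) = A′ , resolving′ , |A′|≤6+k , here refl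
  where
  G′ : Graph
  G′ = Ladder (8 + suc m)

  A′ : List (V G′)
  A′ = landmarks ++ map (shift 8) A

  landmarks⊆A′ : ∀ {z} → z ∈ landmarks → z ∈ A′
  landmarks⊆A′ = ∈-++⁺ˡ

  shifted⊆A′ : ∀ {z} → z ∈ map (shift 8) A → z ∈ A′
  shifted⊆A′ = ∈-++⁺ʳ landmarks

  first-columns⊆A′ : ∀ {z} → z ∈ shift 8 corner ∷ landmarks → z ∈ A′
  first-columns⊆A′ (here refl) = shifted⊆A′ (∈-map⁺ (shift 8) corner∈A)
  first-columns⊆A′ (there z∈) = landmarks⊆A′ z∈

  resolving′ : IsAdjResolving G′ A′
  resolving′ (r , i) (s , j) x≢y with split 8 i | split 8 j
  ... | left k   | left l   = Resolves-⊆ {G′} first-columns⊆A′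
                                (landmarks-resolve-first-columns (r , k) (s , l) (x≢y ∘ cong embedˡ))
  ... | left k   | right j′ = Resolves-⊆ {G′} landmarks⊆A′ (landmarks-separate (r , k) (s , j′))
  ... | right i′ | left l   = Resolves-sym {G′}
                                (Resolves-⊆ {G′} landmarks⊆A′ (landmarks-separate (s , l) (r , i′)))
  ... | right i′ | right j′ = Resolves-⊆ {G′} shifted⊆A′
                                (Resolves-shift 8 (resolving (r , i′) (s , j′) (x≢y ∘ cong (shift 8))))

  |A′|≤6+k : length A′ ≤ 6 + k
  |A′|≤6+k = subst (_≤ 6 + k) (cong (6 +_) (sym (length-map (shift 8) A))) (+-monoʳ-≤ 6 |A|≤k)

period : ∀ n → (3 * (8 + n) + 2) / 4 ≡ 6 + (3 * n + 2) / 4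
period n = begin
  (3 * (8 + n) + 2) / 4   ≡⟨ cong (λ a → (a + 2) / 4) (*-distribˡ-+ 3 8 n) ⟩
  (24 + 3 * n + 2) / 4    ≡⟨ cong (_/ 4) (+-assoc 24 (3 * n) 2) ⟩
  (24 + (3 * n + 2)) / 4  ≡⟨ +-distrib-/-∣ˡ (3 * n + 2) {4} (divides-refl 6) ⟩
  6 + (3 * n + 2) / 4     ∎
  where open ≡-Reasoning

by-computation : ∀ {m k} (rest : List (V (Ladder (suc m)))) →
  {True (isAdjResolving? (suc m) (corner ∷ rest))} → {True (length (corner ∷ rest) ≤? k)} →
  AdjResolvingContaining (Ladder (suc m)) corner k
by-computation rest {resolving} {short} = corner ∷ rest , toWitness resolving , toWitness short , here refl

ladder-bound : ∀ m → AdjResolvingContaining (Ladder (suc m)) corner ((3 * suc m + 2) / 4)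
ladder-bound 0 = by-computation []
ladder-bound 1 = by-computation ((# 0 , # 1) ∷ [])
ladder-bound 2 = by-computation ((# 0 , # 2) ∷ [])
ladder-bound 3 = by-computation ((# 0 , # 2) ∷ (# 0 , # 3) ∷ [])
ladder-bound 4 = by-computation ((# 0 , # 2) ∷ (# 1 , # 2) ∷ (# 0 , # 3) ∷ [])
ladder-bound 5 = by-computation ((# 0 , # 2) ∷ (# 1 , # 2) ∷ (# 1 , # 4) ∷ (# 1 , # 5) ∷ [])
ladder-bound 6 = by-computation ((# 0 , # 2) ∷ (# 1 , # 2) ∷ (# 1 , # 4) ∷ (# 1 , # 6) ∷ [])
ladder-bound 7 = by-computation ((# 0 , # 2) ∷ (# 1 , # 2) ∷ (# 1 , # 4) ∷ (# 1 , # 6) ∷ (# 1 , # 7) ∷ [])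
ladder-bound (suc (suc (suc (suc (suc (suc (suc (suc m)))))))) =
  subst (AdjResolvingContaining (Ladder (9 + m)) corner) (sym (period (suc m))) (extend (ladder-bound m))

lemma4p8 : (n : ℕ) → 2 ≤ n → adim≤ (P 2 □ P n) ((3 * n + 2) / 4)
lemma4p8 zero    ()
lemma4p8 (suc m) _ with ladder-bound m
... | A , resolving , bounded , _ = A , resolving , bounded
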